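{- For every integer $r\ge 1$: $GS(r)=5^{r/2}$ if $r$ is even, and $GS(r)=2\cdot 5^{(r-1)/2}$ if $r$ is odd. Moreover $WGS(1)=3$, and for $r>1$: $WGS(r)=9\cdot 5^{(r-2)/2}$ if $r$ is even and $WGS(r)=18\cdot 5^{(r-3)/2}$ if $r$ is odd; i.e. $WGS(r)=\tfrac{9}{5}GS(r)$ for $r>1$.
   Context: A partition of $[1,n]=\{1,\dots,n\}$ into exactly $r$ non-empty disjoint subsets $S_1,\dots,S_r$ is a (strong) Gallai-Schur $r$-partition if (i) no subset contains integers $a,b,c$ (not necessarily distinct) with $a+b=c$, and (ii) there are no $a,b,c\in[1,n]$ with $a+b=c$ lying in three different subsets. It is a weak Gallai-Schur $r$-partition if (i) is replaced by: no subset contains three distinct integers $a,b,c$ with $a+b=c$; (ii) is kept. The Gallai-Schur number $GS(r)$ is the least integer $n$ such that no Gallai-Schur $r$-partition of $[1,m]$ exists for any integer $m\ge n$; the weak Gallai-Schur number $WGS(r)$ is defined in the same way using weak Gallai-Schur $r$-partitions. -}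

module Defs where

open import Data.Nat using (ℕ; _+_; _≤_)
open import Data.Fin using (Fin)
open import Data.Product using (_×_; ∃)
open import Relation.Nullary using (¬_)
open import Relation.Binary.PropositionalEquality using (_≡_; _≢_)

InRange : ℕ → ℕ → Set
InRange n x = 1 ≤ x × x ≤ n

-- A partition of [1,n] into exactly r non-empty subsets S_1..S_r is encoded
-- by a colouring χ (x ∈ S_j  iff  χ x ≡ j, for x ∈ [1,n]; values of χ
-- outside [1,n] are irrelevant).
AllClassesNonEmpty : (r n : ℕ) → (ℕ → Fin r) → Set
AllClassesNonEmpty r n χ = ∀ (j : Fin r) → ∃ λ x → InRange n x × χ x ≡ j

NoMonoSchurTriple : (r n : ℕ) → (ℕ → Fin r) → Set
NoMonoSchurTriple r n χ =
  ∀ a b → InRange n a → InRange n b → InRange n (a + b) →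
  ¬ (χ a ≡ χ b × χ b ≡ χ (a + b))

-- (i) weak: no monochromatic a + b = c with a, b, c distinct
-- (for positive a, b, c = a + b is automatically distinct from a and b)
NoMonoDistinctSchurTriple : (r n : ℕ) → (ℕ → Fin r) → Set
NoMonoDistinctSchurTriple r n χ =
  ∀ a b → InRange n a → InRange n b → InRange n (a + b) → a ≢ b →
  ¬ (χ a ≡ χ b × χ b ≡ χ (a + b))

NoRainbowSchurTriple : (r n : ℕ) → (ℕ → Fin r) → Set
NoRainbowSchurTriple r n χ =
  ∀ a b → InRange n a → InRange n b → InRange n (a + b) →
  ¬ (χ a ≢ χ b × χ a ≢ χ (a + b) × χ b ≢ χ (a + b))

HasGSPartition : ℕ → ℕ → Set
HasGSPartition r n = ∃ λ (χ : ℕ → Fin r) →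
  AllClassesNonEmpty r n χ × NoMonoSchurTriple r n χ × NoRainbowSchurTriple r n χ

HasWGSPartition : ℕ → ℕ → Set
HasWGSPartition r n = ∃ λ (χ : ℕ → Fin r) →
  AllClassesNonEmpty r n χ × NoMonoDistinctSchurTriple r n χ × NoRainbowSchurTriple r n χ

IsLeastThreshold : (ℕ → Set) → ℕ → Set
IsLeastThreshold Has n =
  (∀ m → n ≤ m → ¬ Has m) ×
  (∀ k → (∀ m → k ≤ m → ¬ Has m) → n ≤ k)

GSis : ℕ → ℕ → Set
GSis r n = IsLeastThreshold (HasGSPartition r) n

WGSis : ℕ → ℕ → Set
WGSis r n = IsLeastThreshold (HasWGSPartition r) n

-- Two local rules drive everything: if a and b have different colours, then a + b has one of
-- them (no rainbow triple); if a ≢ b share a colour, then a + b does not (no monochromatic one).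
-- Upper bound: in a Gallai–Schur colouring of [1,n] these rules applied to 1, …, 10 force one of
-- two patterns.  Either every odd number has the colour of 1; then halving the even numbers
-- gives a colouring of [1,n/2] with one colour fewer.  Or the colouring repeats with period 5
-- the Schur colouring {1,4},{2,3} of ℤ/5 on the non-multiples of 5; then dividing the multiples
-- of 5 by 5 gives a colouring of [1,n/5] with two colours fewer.  Lower bound: conversely, a
-- colouring of [1,N] blown up along the same ℤ/5 pattern is a colouring of [1,5N+4] with two
-- colours more.  Induction on r from one, two (and, for the weak version, three) colours.
module Submission where

open import Defs
open import Data.Nat using (ℕ; zero; suc; _+_; _*_; _^_; _≤_; z≤n; s≤s; _≤?_; NonZero)
open import Data.Nat.Base using (>-nonZero⁻¹)
open import Data.Nat.Properties
  using (_≟_; ≤-refl; ≤-trans; ≤-pred; ≮⇒≥; m≤m+n; m≤n+m; m+n≤o⇒m≤o; m+n≤o⇒n≤o;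
         +-identityʳ; +-comm; *-identityʳ; *-suc; *-comm; *-assoc; *-distribʳ-+; *-monoˡ-≤;
         *-cancelʳ-≡; *-cancelʳ-<; allUpTo?; anyUpTo?; module ≤-Reasoning)
open import Data.Nat.DivMod using (_divMod_; result)
open import Data.Nat.Tactic.RingSolver using (solve-∀)
open import Data.Fin using (Fin; zero; suc; toℕ; punchOut)
open import Data.Fin.Properties using (all?; suc-injective; punchOut-injective)
  renaming (_≟_ to _≟ᶠ_)
open import Data.Product using (_×_; _,_; ∃; proj₁; proj₂; uncurry)
open import Data.Sum using (_⊎_; inj₁; inj₂; [_,_])
open import Data.Unit using (⊤; tt)
open import Data.Empty using (⊥; ⊥-elim)
open import Function using (_∘_)
open import Relation.Nullary using (¬_; Dec; yes; no; ¬?; contradiction)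
open import Relation.Nullary.Decidable
  using (True; False; toWitness; toWitnessFalse; from-yes; decidable-stable; map′; _×-dec_; _→-dec_)
open import Relation.Binary.PropositionalEquality
  using (_≡_; _≢_; refl; sym; trans; cong; subst; ≢-sym; module ≡-Reasoning)

data Strength : Set where
  strong weak : Strength

private
  variable
    s : Strength
    r n m N M a b a′ b′ q q′ : ℕ
    χ : ℕ → Fin r
    C D : Set
    x y z x′ y′ z′ : C

Monochromatic : C → C → C → Set
Monochromatic x y z = x ≡ y × y ≡ z

Rainbow : C → C → C → Set
Rainbow x y z = x ≢ y × x ≢ z × y ≢ z

Distinct : Strength → ℕ → ℕ → Set
Distinct strong a b = ⊤
Distinct weak   a b = a ≢ b

distinct : ∀ s → a ≢ b → Distinct s a b
distinct strong _   = tt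
distinct weak   a≢b = a≢b

Admissible : Strength → ℕ → ℕ → C → C → C → Set
Admissible s a b x y z = (Distinct s a b → ¬ Monochromatic x y z) × ¬ Rainbow x y z

SchurTriple : ℕ → ℕ → ℕ → Set
SchurTriple n a b = 1 ≤ a × 1 ≤ b × a + b ≤ n

GallaiSchur : Strength → (r n : ℕ) → (ℕ → Fin r) → Set
GallaiSchur s r n χ = ∀ a b → SchurTriple n a b → Admissible s a b (χ a) (χ b) (χ (a + b))

Partition : Strength → (r n : ℕ) → (ℕ → Fin r) → Set
Partition s r n χ = AllClassesNonEmpty r n χ × GallaiSchur s r n χ

HasPartition : Strength → ℕ → ℕ → Set
HasPartition strong = HasGSPartition
HasPartition weak   = HasWGSPartition

schurTriple-inRange : SchurTriple n a b → InRange n a × InRange n b × InRange n (a + b)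
schurTriple-inRange {a = a} (1≤a , 1≤b , a+b≤n) =
  (1≤a , m+n≤o⇒m≤o a a+b≤n) , (1≤b , m+n≤o⇒n≤o a a+b≤n) , (≤-trans 1≤a (m≤m+n a _) , a+b≤n)

gallaiSchur-inRange : GallaiSchur s r n χ → InRange n a → InRange n b → InRange n (a + b) →
                      Admissible s a b (χ a) (χ b) (χ (a + b))
gallaiSchur-inRange gs (1≤a , _) (1≤b , _) (_ , a+b≤n) = gs _ _ (1≤a , 1≤b , a+b≤n)

toPartition : ∀ s → ∃ (Partition s r n) → HasPartition s r n
toPartition strong (χ , nonEmpty , gs) =
  χ , nonEmpty , (λ _ _ ra rb rc → proj₁ (gallaiSchur-inRange gs ra rb rc) tt)
               , (λ _ _ ra rb rc → proj₂ (gallaiSchur-inRange gs ra rb rc))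
toPartition weak (χ , nonEmpty , gs) =
  χ , nonEmpty , (λ _ _ ra rb rc → proj₁ (gallaiSchur-inRange gs ra rb rc))
               , (λ _ _ ra rb rc → proj₂ (gallaiSchur-inRange gs ra rb rc))

fromPartition : ∀ s → HasPartition s r n → ∃ (GallaiSchur s r n)
fromPartition strong (χ , _ , noMono , noRainbow) = χ , λ a b t →
  let (ra , rb , rc) = schurTriple-inRange t in (λ _ → noMono a b ra rb rc) , noRainbow a b ra rb rc
fromPartition weak (χ , _ , noMono , noRainbow) = χ , λ a b t →
  let (ra , rb , rc) = schurTriple-inRange t in noMono a b ra rb rc , noRainbow a b ra rb rc

admissible-distinct : (Distinct s a b → Distinct s a′ b′) →
                      Admissible s a′ b′ x y z → Admissible s a b x y z
admissible-distinct f (noMono , noRainbow) = noMono ∘ f , noRainbow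

admissible : ¬ Monochromatic x y z → ¬ Rainbow x y z → Admissible s a b x y z
admissible noMono noRainbow = (λ _ → noMono) , noRainbow

admissible-resp : x ≡ x′ → y ≡ y′ → z ≡ z′ →
                  Admissible s a b x y z → Admissible s a b x′ y′ z′
admissible-resp refl refl refl adm = adm

admissible-recolour : (g : C → D) → (g x ≡ g y → x ≡ y) → (g y ≡ g z → y ≡ z) →
                      Admissible s a b x y z → Admissible s a b (g x) (g y) (g z)
admissible-recolour g injxy injyz (noMono , noRainbow) =
    (λ d (gx≡gy , gy≡gz) → noMono d (injxy gx≡gy , injyz gy≡gz))
  , (λ (gx≢gy , gx≢gz , gy≢gz) → noRainbow (gx≢gy ∘ cong g , gx≢gz ∘ cong g , gy≢gz ∘ cong g))

restrict : m ≤ n → GallaiSchur s r n χ → GallaiSchur s r m χ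
restrict m≤n gs a b (1≤a , 1≤b , a+b≤m) = gs a b (1≤a , 1≤b , ≤-trans a+b≤m m≤n)

scale-positive : ∀ d → 1 ≤ a → 1 ≤ a * suc d
scale-positive {suc _} _ _ = s≤s z≤n

distinct-scale : ∀ s d → Distinct s a b → Distinct s (a * suc d) (b * suc d)
distinct-scale strong d _   = tt
distinct-scale weak   d a≢b = a≢b ∘ *-cancelʳ-≡ _ _ (suc d)

distinct-unscale : ∀ s d → Distinct s (a * suc d) (b * suc d) → Distinct s a b
distinct-unscale strong d _   = tt
distinct-unscale weak   d ad≢bd = ad≢bd ∘ cong (_* suc d)

dilate : ∀ d → M * suc d ≤ n → GallaiSchur s r n χ → GallaiSchur s r M (λ y → χ (y * suc d))
dilate {M} {n} {χ = χ} d M*d≤n gs a b (1≤a , 1≤b , a+b≤M) =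
  admissible-resp refl refl (cong χ (sym (*-distribʳ-+ (suc d) a b)))
    (admissible-distinct (distinct-scale _ d)
      (gs (a * suc d) (b * suc d) (scale-positive d 1≤a , scale-positive d 1≤b , bound)))
  where
  open ≤-Reasoning
  bound : a * suc d + b * suc d ≤ n
  bound = begin
    a * suc d + b * suc d ≡⟨ *-distribʳ-+ (suc d) a b ⟨
    (a + b) * suc d       ≤⟨ *-monoˡ-≤ (suc d) a+b≤M ⟩
    M * suc d             ≤⟨ M*d≤n ⟩
    n                     ∎

-- The value zero at c itself is junk: it is only used on colours a colouring avoids.
removeColour : Fin (suc (suc r)) → Fin (suc (suc r)) → Fin (suc r)
removeColour c x with c ≟ᶠ x
... | yes _   = zero
... | no c≢x = punchOut c≢x

removeColour-injective : ∀ {c x y : Fin (suc (suc r))} → c ≢ x → c ≢ y →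
                         removeColour c x ≡ removeColour c y → x ≡ y
removeColour-injective {c = c} {x} {y} c≢x c≢y eq with c ≟ᶠ x | c ≟ᶠ y
... | yes c≡x | _       = contradiction c≡x c≢x
... | no _    | yes c≡y = contradiction c≡y c≢y
... | no c≢x′ | no c≢y′ = punchOut-injective c≢x′ c≢y′ eq

Avoids : ℕ → (ℕ → Fin r) → Fin r → Set
Avoids n χ c = ∀ {x} → InRange n x → χ x ≢ c

removeAvoided : ∀ {c} → Avoids n χ c → GallaiSchur s (suc (suc r)) n χ →
                GallaiSchur s (suc r) n (removeColour c ∘ χ)
removeAvoided {n} {χ = χ} {c = c} avoids gs a b t =
  admissible-recolour (removeColour c) (injective ra rb) (injective rb rc) (gs a b t)
  where
  ra = proj₁ (schurTriple-inRange t)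
  rb = proj₁ (proj₂ (schurTriple-inRange t))
  rc = proj₂ (proj₂ (schurTriple-inRange t))
  injective : ∀ {x y} → InRange n x → InRange n y →
              removeColour c (χ x) ≡ removeColour c (χ y) → χ x ≡ χ y
  injective rx ry = removeColour-injective (≢-sym (avoids rx)) (≢-sym (avoids ry))

removeColour-avoids : ∀ {c d} → Avoids n χ c → Avoids n χ d → c ≢ d →
                      Avoids n (removeColour c ∘ χ) (removeColour c d)
removeColour-avoids avoids-c avoids-d c≢d rx =
  avoids-d rx ∘ removeColour-injective (≢-sym (avoids-c rx)) c≢d

module SumRules {s r n} {χ : ℕ → Fin r} (gs : GallaiSchur s r n χ) where

  private
    triple : ∀ a b .{{_ : NonZero a}} .{{_ : NonZero b}} → a + b ≤ n → SchurTriple n a b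
    triple a b a+b≤n = >-nonZero⁻¹ a , >-nonZero⁻¹ b , a+b≤n

  sum-≢ : ∀ a b .{{_ : NonZero a}} .{{_ : NonZero b}} {x : Fin r} → a + b ≤ n → a ≢ b →
          χ a ≡ x → χ b ≡ x → χ (a + b) ≢ x
  sum-≢ a b a+b≤n a≢b χa≡x χb≡x χc≡x =
    proj₁ (gs a b (triple a b a+b≤n)) (distinct s a≢b)
      (trans χa≡x (sym χb≡x) , trans χb≡x (sym χc≡x))

  rainbow-free : ∀ a b .{{_ : NonZero a}} .{{_ : NonZero b}} {x y z : Fin r} → a + b ≤ n →
                 χ a ≡ x → χ b ≡ y → χ (a + b) ≡ z → ¬ Rainbow x y z
  rainbow-free a b a+b≤n refl refl refl = proj₂ (gs a b (triple a b a+b≤n))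

  sum-≡ˡ : ∀ a b .{{_ : NonZero a}} .{{_ : NonZero b}} {x y : Fin r} → a + b ≤ n →
           χ a ≡ x → χ b ≡ y → x ≢ y → χ (a + b) ≢ y → χ (a + b) ≡ x
  sum-≡ˡ a b a+b≤n χa≡x χb≡y x≢y c≢y = decidable-stable (χ (a + b) ≟ᶠ _) λ c≢x →
    rainbow-free a b a+b≤n χa≡x χb≡y refl (x≢y , ≢-sym c≢x , ≢-sym c≢y)

  sum-≡ʳ : ∀ a b .{{_ : NonZero a}} .{{_ : NonZero b}} {x y : Fin r} → a + b ≤ n →
           χ a ≡ x → χ b ≡ y → x ≢ y → χ (a + b) ≢ x → χ (a + b) ≡ y
  sum-≡ʳ a b a+b≤n χa≡x χb≡y x≢y c≢x = decidable-stable (χ (a + b) ≟ᶠ _) λ c≢y →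
    rainbow-free a b a+b≤n χa≡x χb≡y refl (x≢y , ≢-sym c≢x , ≢-sym c≢y)

  sum-∈ : ∀ a b .{{_ : NonZero a}} .{{_ : NonZero b}} {x y : Fin r} → a + b ≤ n →
          χ a ≡ x → χ b ≡ y → x ≢ y → χ (a + b) ≡ x ⊎ χ (a + b) ≡ y
  sum-∈ a b a+b≤n χa≡x χb≡y x≢y with χ (a + b) ≟ᶠ _
  ... | yes c≡y = inj₂ c≡y
  ... | no c≢y  = inj₁ (sum-≡ˡ a b a+b≤n χa≡x χb≡y x≢y c≢y)

module LiteralSumRules {s r n} {χ : ℕ → Fin r} (gs : GallaiSchur s r n χ) where

  private module R = SumRules gs

  sum-≢ : ∀ a b .{{_ : NonZero a}} .{{_ : NonZero b}} {x : Fin r}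
          {a+b≤n : True (a + b ≤? n)} {a≢b : False (a ≟ b)} →
          χ a ≡ x → χ b ≡ x → χ (a + b) ≢ x
  sum-≢ a b {a+b≤n = a+b≤n} {a≢b} = R.sum-≢ a b (toWitness a+b≤n) (toWitnessFalse a≢b)

  rainbow-free : ∀ a b .{{_ : NonZero a}} .{{_ : NonZero b}} {x y z : Fin r}
                 {a+b≤n : True (a + b ≤? n)} →
                 χ a ≡ x → χ b ≡ y → χ (a + b) ≡ z → ¬ Rainbow x y z
  rainbow-free a b {a+b≤n = a+b≤n} = R.rainbow-free a b (toWitness a+b≤n)

  sum-≡ˡ : ∀ a b .{{_ : NonZero a}} .{{_ : NonZero b}} {x y : Fin r}
           {a+b≤n : True (a + b ≤? n)} →
           χ a ≡ x → χ b ≡ y → x ≢ y → χ (a + b) ≢ y → χ (a + b) ≡ x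
  sum-≡ˡ a b {a+b≤n = a+b≤n} = R.sum-≡ˡ a b (toWitness a+b≤n)

  sum-≡ʳ : ∀ a b .{{_ : NonZero a}} .{{_ : NonZero b}} {x y : Fin r}
           {a+b≤n : True (a + b ≤? n)} →
           χ a ≡ x → χ b ≡ y → x ≢ y → χ (a + b) ≢ x → χ (a + b) ≡ y
  sum-≡ʳ a b {a+b≤n = a+b≤n} = R.sum-≡ʳ a b (toWitness a+b≤n)

  sum-∈ : ∀ a b .{{_ : NonZero a}} .{{_ : NonZero b}} {x y : Fin r}
          {a+b≤n : True (a + b ≤? n)} →
          χ a ≡ x → χ b ≡ y → x ≢ y → χ (a + b) ≡ x ⊎ χ (a + b) ≡ y
  sum-∈ a b {a+b≤n = a+b≤n} = R.sum-∈ a b (toWitness a+b≤n)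

ParityPattern : (ℕ → Fin r) → Set
ParityPattern χ = χ 2 ≢ χ 1 × χ 3 ≡ χ 1 × χ 5 ≡ χ 1

PentagonPattern : (ℕ → Fin r) → Set
PentagonPattern χ = χ 2 ≢ χ 1 × χ 3 ≡ χ 2 × χ 4 ≡ χ 1 × χ 5 ≢ χ 1 × χ 5 ≢ χ 2

-- The colour words of 1, …, 5 possible once χ 2 ≢ χ 1, writing A = χ 1 and B = χ 2; hypothesis
-- names below use the same letters, with C and D for further colours.
data Prefix₅ (χ : ℕ → Fin r) : Set where
  parity   : ParityPattern χ → Prefix₅ χ
  pentagon : PentagonPattern χ → Prefix₅ χ
  ABABB    : χ 3 ≡ χ 1 → χ 4 ≡ χ 2 → χ 5 ≡ χ 2 → Prefix₅ χ
  ABBB     : χ 3 ≡ χ 2 → χ 4 ≡ χ 2 → Prefix₅ χ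

module _ (gs : GallaiSchur s r 5 χ) where
  open LiteralSumRules gs

  prefix₅ : χ 2 ≢ χ 1 → Prefix₅ χ
  prefix₅ B≢A with sum-∈ 1 2 refl refl (≢-sym B≢A)
  ... | inj₂ χ3≡B with sum-∈ 1 3 refl χ3≡B (≢-sym B≢A)
  ...   | inj₁ χ4≡A = pentagon (B≢A , χ3≡B , χ4≡A , sum-≢ 1 4 refl χ4≡A , sum-≢ 2 3 refl χ3≡B)
  ...   | inj₂ χ4≡B = ABBB χ3≡B χ4≡B
  prefix₅ B≢A | inj₁ χ3≡A with sum-∈ 1 4 refl refl (≢-sym (sum-≢ 1 3 refl χ3≡A))
  ...   | inj₁ χ5≡A = parity (B≢A , χ3≡A , χ5≡A)
  ...   | inj₂ χ5≡χ4 with sum-∈ 2 3 refl χ3≡A B≢A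
  ...     | inj₁ χ5≡B = ABABB χ3≡A (trans (sym χ5≡χ4) χ5≡B) χ5≡B
  ...     | inj₂ χ5≡A = parity (B≢A , χ3≡A , χ5≡A)

module _ (gs : GallaiSchur s r 6 χ) where
  open LiteralSumRules gs

  ABBB-rainbow : χ 2 ≢ χ 1 → χ 3 ≡ χ 2 → χ 4 ≡ χ 2 → Rainbow (χ 1) (χ 2) (χ 6)
  ABBB-rainbow B≢A χ3≡B χ4≡B = ≢-sym B≢A , ≢-sym (sum-≢ 1 5 refl χ5≡A) , ≢-sym (sum-≢ 2 4 refl χ4≡B)
    where
    χ5≡A : χ 5 ≡ χ 1
    χ5≡A = sum-≡ˡ 1 4 refl χ4≡B (≢-sym B≢A) (sum-≢ 2 3 refl χ3≡B)

module _ (gs : GallaiSchur s r 7 χ) where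
  open LiteralSumRules gs

  ABABB-impossible : χ 2 ≢ χ 1 → χ 3 ≡ χ 1 → χ 4 ≡ χ 2 → χ 5 ≡ χ 2 → ⊥
  ABABB-impossible B≢A χ3≡A χ4≡B χ5≡B =
    rainbow-free 3 4 χ3≡A χ4≡B refl
      (≢-sym B≢A , ≢-sym (sum-≢ 1 6 refl χ6≡A) , ≢-sym (sum-≢ 2 5 refl χ5≡B))
    where
    χ6≡A : χ 6 ≡ χ 1
    χ6≡A = sum-≡ˡ 1 5 refl χ5≡B (≢-sym B≢A) (sum-≢ 2 4 refl χ4≡B)

module _ (gs : GallaiSchur s r 9 χ) where
  open LiteralSumRules gs

  χ2≢χ1-on-[1,9] : χ 2 ≢ χ 1
  χ2≢χ1-on-[1,9] χ2≡A = [ case-χ4≡A , case-χ4≡C ] (sum-∈ 1 3 refl refl A≢C)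
    where
    A≢C : χ 1 ≢ χ 3
    A≢C = ≢-sym (sum-≢ 1 2 refl χ2≡A)

    case-χ4≡A : χ 4 ≡ χ 1 → ⊥
    case-χ4≡A χ4≡A = [ case-χ7≡A , case-χ7≡C ] (sum-∈ 1 6 refl χ6≡C A≢C)
      where
      χ5≡C : χ 5 ≡ χ 3
      χ5≡C = sum-≡ʳ 2 3 χ2≡A refl A≢C (sum-≢ 1 4 refl χ4≡A)
      χ6≡C : χ 6 ≡ χ 3
      χ6≡C = sum-≡ʳ 1 5 refl χ5≡C A≢C (sum-≢ 2 4 χ2≡A χ4≡A)
      χ8≢C : χ 8 ≢ χ 3
      χ8≢C = sum-≢ 3 5 refl χ5≡C
      case-χ7≡A : χ 7 ≡ χ 1 → ⊥
      case-χ7≡A χ7≡A =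
        rainbow-free 2 6 χ2≡A χ6≡C refl (A≢C , ≢-sym (sum-≢ 1 7 refl χ7≡A) , ≢-sym χ8≢C)
      case-χ7≡C : χ 7 ≡ χ 3 → ⊥
      case-χ7≡C χ7≡C =
        rainbow-free 4 5 χ4≡A χ5≡C refl
          (A≢C , ≢-sym (sum-≢ 1 8 refl χ8≡A) , ≢-sym (sum-≢ 3 6 refl χ6≡C))
        where
        χ8≡A : χ 8 ≡ χ 1
        χ8≡A = sum-≡ˡ 1 7 refl χ7≡C A≢C χ8≢C

    case-χ4≡C : χ 4 ≡ χ 3 → ⊥
    case-χ4≡C χ4≡C = [ case-χ5≡A , case-χ5≡C ] (sum-∈ 1 4 refl χ4≡C A≢C)
      where
      χ7≢C : χ 7 ≢ χ 3
      χ7≢C = sum-≢ 3 4 refl χ4≡C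
      case-χ5≡A : χ 5 ≡ χ 1 → ⊥
      case-χ5≡A χ5≡A =
        rainbow-free 1 6 refl χ6≡C refl (A≢C , ≢-sym (sum-≢ 2 5 χ2≡A χ5≡A) , ≢-sym χ7≢C)
        where
        χ6≡C : χ 6 ≡ χ 3
        χ6≡C = sum-≡ʳ 2 4 χ2≡A χ4≡C A≢C (sum-≢ 1 5 refl χ5≡A)
      case-χ5≡C : χ 5 ≡ χ 3 → ⊥
      case-χ5≡C χ5≡C = [ case-χ6≡A , case-χ6≡C ] (sum-∈ 1 5 refl χ5≡C A≢C)
        where
        case-χ6≡A : χ 6 ≡ χ 1 → ⊥
        case-χ6≡A χ6≡A =
          rainbow-free 2 5 χ2≡A χ5≡C refl (A≢C , ≢-sym (sum-≢ 1 6 refl χ6≡A) , ≢-sym χ7≢C)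
        case-χ6≡C : χ 6 ≡ χ 3 → ⊥
        case-χ6≡C χ6≡C =
          rainbow-free 2 6 χ2≡A χ6≡C refl
            (A≢C , ≢-sym (sum-≢ 1 7 refl χ7≡A) , ≢-sym (sum-≢ 3 5 refl χ5≡C))
          where
          χ7≡A : χ 7 ≡ χ 1
          χ7≡A = sum-≡ˡ 1 6 refl χ6≡C A≢C χ7≢C

module _ (gs : GallaiSchur s r 10 χ) where
  open LiteralSumRules gs

  ABBB-impossible : χ 2 ≢ χ 1 → χ 3 ≡ χ 2 → χ 4 ≡ χ 2 → ⊥
  ABBB-impossible B≢A χ3≡B χ4≡B = rainbow-free 4 6 χ4≡B refl χ10≡A (B≢C , B≢A , C≢A)
    where
    A≢B : χ 1 ≢ χ 2
    A≢B = ≢-sym B≢A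
    ABC : Rainbow (χ 1) (χ 2) (χ 6)
    ABC = ABBB-rainbow (restrict (from-yes (6 ≤? 10)) gs) B≢A χ3≡B χ4≡B
    A≢C : χ 1 ≢ χ 6
    A≢C = proj₁ (proj₂ ABC)
    B≢C : χ 2 ≢ χ 6
    B≢C = proj₂ (proj₂ ABC)
    C≢A : χ 6 ≢ χ 1
    C≢A = ≢-sym A≢C
    χ5≡A : χ 5 ≡ χ 1
    χ5≡A = sum-≡ˡ 1 4 refl χ4≡B A≢B (sum-≢ 2 3 refl χ3≡B)
    χ7≡A : χ 7 ≡ χ 1
    χ7≡A = sum-≡ˡ 1 6 refl refl A≢C λ χ7≡C → rainbow-free 2 5 refl χ5≡A χ7≡C (B≢A , B≢C , A≢C)
    χ8≡B : χ 8 ≡ χ 2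
    χ8≡B = sum-≡ˡ 3 5 χ3≡B χ5≡A B≢A (sum-≢ 1 7 refl χ7≡A)
    χ9≡B : χ 9 ≡ χ 2
    χ9≡B = sum-≡ʳ 1 8 refl χ8≡B A≢B λ χ9≡A → rainbow-free 3 6 χ3≡B refl χ9≡A (B≢C , B≢A , C≢A)
    χ10≡A : χ 10 ≡ χ 1
    χ10≡A = sum-≡ˡ 1 9 refl χ9≡B A≢B (sum-≢ 2 8 refl χ8≡B)

PentagonBlock : (ℕ → Fin r) → ℕ → Set
PentagonBlock χ t = χ (4 + t) ≡ χ 1 × χ (5 + t) ≢ χ 1 × χ (5 + t) ≢ χ 2

module _ (gs : GallaiSchur s r n χ) where
  open SumRules gs

  parity-odd : ParityPattern χ → ∀ k → 1 + k * 2 ≤ n → χ (1 + k * 2) ≡ χ 1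
  parity-odd _               0 _ = refl
  parity-odd (_ , χ3≡A , _) 1 _ = χ3≡A
  parity-odd (_ , _ , χ5≡A) 2 _ = χ5≡A
  parity-odd p@(B≢A , χ3≡A , χ5≡A) (suc (suc (suc k))) h =
    decidable-stable (χ (7 + t) ≟ᶠ χ 1) λ c≢A →
      sum-≢ 2 4 (m+n≤o⇒m≤o 6 h) (λ ())
        (sym (sum-≡ˡ 2 (5 + t) h refl (parity-odd p (suc (suc k)) (m+n≤o⇒n≤o 2 h)) B≢A c≢A))
        (sym (sum-≡ˡ 4 (3 + t) h refl (parity-odd p (suc k) (m+n≤o⇒n≤o 4 h)) χ4≢A c≢A))
        (sym (sum-≡ˡ 6 (1 + t) h refl (parity-odd p k (m+n≤o⇒n≤o 6 h)) χ6≢A c≢A))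
    where
    t : ℕ
    t = k * 2
    χ4≢A : χ 4 ≢ χ 1
    χ4≢A = sum-≢ 1 3 (m+n≤o⇒m≤o 4 h) (λ ()) refl χ3≡A
    χ6≢A : χ 6 ≢ χ 1
    χ6≢A = sum-≢ 1 5 (m+n≤o⇒m≤o 6 h) (λ ()) refl χ5≡A

  parity-even : ParityPattern χ → ∀ {y} → 1 ≤ y → y * 2 ≤ n → χ (y * 2) ≢ χ 1
  parity-even (B≢A , _) {1} _ _ = B≢A
  parity-even p {suc (suc k)} _ h =
    sum-≢ 1 (3 + k * 2) h (λ ()) refl (parity-odd p (suc k) (m+n≤o⇒n≤o 1 h))

  pentagon-step : PentagonPattern χ → ∀ t → 10 + t ≤ n → PentagonBlock χ t → PentagonBlock χ (5 + t)
  pentagon-step (B≢A , χ3≡B , _) t h (χ4≡A , D≢A , D≢B) =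
    χ9≡A , sum-≢ 1 (9 + t) h (λ ()) refl χ9≡A , sum-≢ 2 (8 + t) h (λ ()) refl χ8≡B
    where
    A≢B : χ 1 ≢ χ 2
    A≢B = ≢-sym B≢A
    χ6≡A : χ (6 + t) ≡ χ 1
    χ6≡A = sum-≡ʳ 2 (4 + t) (m+n≤o⇒n≤o 4 h) refl χ4≡A B≢A λ χ6≡B →
      rainbow-free 1 (5 + t) (m+n≤o⇒n≤o 4 h) refl refl χ6≡B (≢-sym D≢A , A≢B , D≢B)
    χ7≡B : χ (7 + t) ≡ χ 2
    χ7≡B = sum-≡ˡ 3 (4 + t) (m+n≤o⇒n≤o 3 h) χ3≡B χ4≡A B≢A
      (sum-≢ 1 (6 + t) (m+n≤o⇒n≤o 3 h) (λ ()) refl χ6≡A)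
    χ8≡B : χ (8 + t) ≡ χ 2
    χ8≡B = sum-≡ʳ 1 (7 + t) (m+n≤o⇒n≤o 2 h) refl χ7≡B A≢B λ χ8≡A →
      rainbow-free 3 (5 + t) (m+n≤o⇒n≤o 2 h) χ3≡B refl χ8≡A (≢-sym D≢B , B≢A , D≢A)
    χ9≡A : χ (9 + t) ≡ χ 1
    χ9≡A = sum-≡ˡ 1 (8 + t) (m+n≤o⇒n≤o 1 h) refl χ8≡B A≢B
      (sum-≢ 2 (7 + t) (m+n≤o⇒n≤o 1 h) (λ ()) refl χ7≡B)

  pentagon-blocks : PentagonPattern χ → ∀ q → 5 + q * 5 ≤ n → PentagonBlock χ (q * 5)
  pentagon-blocks (_ , _ , χ4≡A , χ5≢A , χ5≢B) zero _ = χ4≡A , χ5≢A , χ5≢B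
  pentagon-blocks p (suc q) h = pentagon-step p (q * 5) h (pentagon-blocks p q (m+n≤o⇒n≤o 5 h))

  pentagon-multiples : PentagonPattern χ → ∀ {y} → 1 ≤ y → y * 5 ≤ n →
                       χ (y * 5) ≢ χ 1 × χ (y * 5) ≢ χ 2
  pentagon-multiples p {suc q} _ h = proj₂ (pentagon-blocks p q h)

parity-reduction : GallaiSchur s (suc (suc r)) n χ → ParityPattern χ → M * 2 ≤ n →
                   ∃ (GallaiSchur s (suc r) M)
parity-reduction {χ = χ} {M = M} gs p M*2≤n = _ , removeAvoided avoids (dilate 1 M*2≤n gs)
  where
  avoids : Avoids M (λ y → χ (y * 2)) (χ 1)
  avoids (1≤y , y≤M) = parity-even gs p 1≤y (≤-trans (*-monoˡ-≤ 2 y≤M) M*2≤n)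

pentagon-reduction : GallaiSchur s (suc (suc (suc r))) n χ → PentagonPattern χ → M * 5 ≤ n →
                     ∃ (GallaiSchur s (suc r) M)
pentagon-reduction {χ = χ} {M = M} gs p@(B≢A , _) M*5≤n =
  _ , removeAvoided avoids-χ2 (removeAvoided avoids-χ1 (dilate 4 M*5≤n gs))
  where
  multiples : ∀ {y} → InRange M y → χ (y * 5) ≢ χ 1 × χ (y * 5) ≢ χ 2
  multiples (1≤y , y≤M) = pentagon-multiples gs p 1≤y (≤-trans (*-monoˡ-≤ 5 y≤M) M*5≤n)
  avoids-χ1 : Avoids M (λ y → χ (y * 5)) (χ 1)
  avoids-χ1 = proj₁ ∘ multiples
  avoids-χ2 : Avoids M (removeColour (χ 1) ∘ λ y → χ (y * 5)) (removeColour (χ 1) (χ 2))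
  avoids-χ2 = removeColour-avoids avoids-χ1 (proj₂ ∘ multiples) (≢-sym B≢A)

maxSize : Strength → ℕ → ℕ
maxSize strong 0                         = 0
maxSize strong 1                         = 1
maxSize strong (suc (suc r))             = 4 + maxSize strong r * 5
maxSize weak   0                         = 0
maxSize weak   1                         = 2
maxSize weak   2                         = 8
maxSize weak   3                         = 17
maxSize weak   (suc (suc (suc (suc r)))) = 4 + maxSize weak (suc (suc r)) * 5

threshold : Strength → ℕ → ℕ
threshold s r = suc (maxSize s r)

×5-preserves-double : ∀ x {y} → x * 2 ≤ y → x * 5 * 2 ≤ y * 5
×5-preserves-double x {y} x*2≤y = begin
  x * 5 * 2 ≡⟨ *-assoc x 5 2 ⟩
  x * 10    ≡⟨ *-assoc x 2 5 ⟨
  x * 2 * 5 ≤⟨ *-monoˡ-≤ 5 x*2≤y ⟩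
  y * 5     ∎
  where open ≤-Reasoning

threshold-double : ∀ s r → threshold s (suc r) * 2 ≤ threshold s (2 + r)
threshold-double strong 0                   = from-yes (4 ≤? 5)
threshold-double strong 1                   = ≤-refl
threshold-double strong (suc (suc r))       =
  ×5-preserves-double (threshold strong (suc r)) (threshold-double strong r)
threshold-double weak   0                   = from-yes (6 ≤? 9)
threshold-double weak   1                   = ≤-refl
threshold-double weak   2                   = from-yes (36 ≤? 45)
threshold-double weak   (suc (suc (suc r))) =
  ×5-preserves-double (threshold weak (2 + r)) (threshold-double weak (suc r))

threshold-quintuple : ∀ s r → threshold s (suc r) * 5 ≤ threshold s (3 + r)
threshold-quintuple strong r       = ≤-refl
threshold-quintuple weak   0       = from-yes (15 ≤? 18)
threshold-quintuple weak   (suc r) = ≤-refl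

5≤threshold-strong : ∀ r → 5 ≤ threshold strong (2 + r)
5≤threshold-strong r = *-monoˡ-≤ 5 {1} {threshold strong r} (s≤s z≤n)

9≤threshold-weak : ∀ r → 9 ≤ threshold weak (2 + r)
9≤threshold-weak 0             = ≤-refl
9≤threshold-weak 1             = from-yes (9 ≤? 18)
9≤threshold-weak (suc (suc r)) = ≤-trans (from-yes (9 ≤? 45)) (*-monoˡ-≤ 5 (9≤threshold-weak r))

10≤threshold-weak : ∀ r → 10 ≤ threshold weak (3 + r)
10≤threshold-weak 0       = from-yes (10 ≤? 18)
10≤threshold-weak (suc r) = ≤-trans (from-yes (10 ≤? 45)) (*-monoˡ-≤ 5 (9≤threshold-weak r))

fin1-monochromatic : (x y z : Fin 1) → Monochromatic x y z
fin1-monochromatic zero zero zero = refl , refl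

fin2-rainbow-free : (x y z : Fin 2) → ¬ Rainbow x y z
fin2-rainbow-free zero       zero       _          (x≢y , _)     = x≢y refl
fin2-rainbow-free (suc zero) (suc zero) _          (x≢y , _)     = x≢y refl
fin2-rainbow-free zero       (suc zero) zero       (_ , x≢z , _) = x≢z refl
fin2-rainbow-free (suc zero) zero       (suc zero) (_ , x≢z , _) = x≢z refl
fin2-rainbow-free zero       (suc zero) (suc zero) (_ , _ , y≢z) = y≢z refl
fin2-rainbow-free (suc zero) zero       zero       (_ , _ , y≢z) = y≢z refl

one-colour : ∀ s → threshold s 1 ≤ m → ¬ GallaiSchur s 1 m χ
one-colour strong 2≤m gs = proj₁ (gs 1 1 (≤-refl , ≤-refl , 2≤m)) tt (fin1-monochromatic _ _ _)
one-colour weak   3≤m gs = proj₁ (gs 1 2 (≤-refl , s≤s z≤n , 3≤m)) (λ ()) (fin1-monochromatic _ _ _)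

double-≢ : GallaiSchur strong r n χ → 1 ≤ a → a + a ≤ n → χ (a + a) ≢ χ a
double-≢ gs 1≤a a+a≤n χ2a≡χa = proj₁ (gs _ _ (1≤a , 1≤a , a+a≤n)) tt (refl , sym χ2a≡χa)

ABBB-excluded : ∀ r {χ : ℕ → Fin (suc (suc r))} → threshold weak (2 + r) ≤ m →
                GallaiSchur s (suc (suc r)) m χ → χ 2 ≢ χ 1 → χ 3 ≡ χ 2 → χ 4 ≡ χ 2 → ⊥
ABBB-excluded zero {χ} T≤m gs B≢A χ3≡B χ4≡B =
  fin2-rainbow-free (χ 1) (χ 2) (χ 6)
    (ABBB-rainbow (restrict (≤-trans (from-yes (6 ≤? 9)) T≤m) gs) B≢A χ3≡B χ4≡B)
ABBB-excluded (suc r) T≤m gs = ABBB-impossible (restrict (≤-trans (10≤threshold-weak r) T≤m) gs)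

parityOrPentagon : (χ 3 ≡ χ 1 → χ 4 ≡ χ 2 → χ 5 ≡ χ 2 → ⊥) → (χ 3 ≡ χ 2 → χ 4 ≡ χ 2 → ⊥) →
                   Prefix₅ χ → ParityPattern χ ⊎ PentagonPattern χ
parityOrPentagon _        _       (parity p)       = inj₁ p
parityOrPentagon _        _       (pentagon p)     = inj₂ p
parityOrPentagon no-ABABB _       (ABABB e₃ e₄ e₅) = ⊥-elim (no-ABABB e₃ e₄ e₅)
parityOrPentagon _        no-ABBB (ABBB e₃ e₄)     = ⊥-elim (no-ABBB e₃ e₄)

classify : ∀ s {r m} {χ : ℕ → Fin (suc (suc r))} → threshold s (2 + r) ≤ m →
           GallaiSchur s (suc (suc r)) m χ → ParityPattern χ ⊎ PentagonPattern χ
classify strong {r} {m} {χ} T≤m gs =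
  parityOrPentagon (λ _ χ4≡χ2 _ → χ4≢χ2 χ4≡χ2) (λ _ → χ4≢χ2) (prefix₅ (restrict 5≤m gs) χ2≢χ1)
  where
  5≤m : 5 ≤ m
  5≤m = ≤-trans (5≤threshold-strong r) T≤m
  χ2≢χ1 : χ 2 ≢ χ 1
  χ2≢χ1 = double-≢ gs (s≤s z≤n) (≤-trans (from-yes (2 ≤? 5)) 5≤m)
  χ4≢χ2 : χ 4 ≢ χ 2
  χ4≢χ2 = double-≢ gs (s≤s z≤n) (≤-trans (from-yes (4 ≤? 5)) 5≤m)
classify weak {r} {m} {χ} T≤m gs =
  parityOrPentagon (ABABB-impossible (restrict (≤-trans (from-yes (7 ≤? 9)) 9≤m) gs) χ2≢χ1)
                   (ABBB-excluded r T≤m gs χ2≢χ1)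
                   (prefix₅ (restrict (≤-trans (from-yes (5 ≤? 9)) 9≤m) gs) χ2≢χ1)
  where
  9≤m : 9 ≤ m
  9≤m = ≤-trans (9≤threshold-weak r) T≤m
  χ2≢χ1 : χ 2 ≢ χ 1
  χ2≢χ1 = χ2≢χ1-on-[1,9] (restrict 9≤m gs)

noGallaiSchur : ∀ s r {m} {χ : ℕ → Fin (suc r)} → threshold s (suc r) ≤ m →
                ¬ GallaiSchur s (suc r) m χ
noGallaiSchur s zero T≤m gs = one-colour s T≤m gs
noGallaiSchur s (suc r) T≤m gs with classify s T≤m gs
... | inj₁ p = noGallaiSchur s r ≤-refl
  (proj₂ (parity-reduction gs p (≤-trans (threshold-double s r) T≤m)))
noGallaiSchur s (suc zero) {χ = χ} T≤m gs | inj₂ (B≢A , _ , _ , D≢A , D≢B) =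
  fin2-rainbow-free (χ 1) (χ 2) (χ 5) (≢-sym B≢A , ≢-sym D≢A , ≢-sym D≢B)
noGallaiSchur s (suc (suc r)) T≤m gs | inj₂ p = noGallaiSchur s r ≤-refl
  (proj₂ (pentagon-reduction gs p (≤-trans (threshold-quintuple s r) T≤m)))

schurTriple? : ∀ n a b → Dec (SchurTriple n a b)
schurTriple? n a b = 1 ≤? a ×-dec 1 ≤? b ×-dec a + b ≤? n

distinct? : ∀ s a b → Dec (Distinct s a b)
distinct? strong a b = yes tt
distinct? weak   a b = ¬? (a ≟ b)

monochromatic? : (x y z : Fin r) → Dec (Monochromatic x y z)
monochromatic? x y z = x ≟ᶠ y ×-dec y ≟ᶠ z

rainbow? : (x y z : Fin r) → Dec (Rainbow x y z)
rainbow? x y z = ¬? (x ≟ᶠ y) ×-dec ¬? (x ≟ᶠ z) ×-dec ¬? (y ≟ᶠ z)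

admissible? : ∀ s a b (x y z : Fin r) → Dec (Admissible s a b x y z)
admissible? s a b x y z =
  (distinct? s a b →-dec ¬? (monochromatic? x y z)) ×-dec ¬? (rainbow? x y z)

gallaiSchur? : ∀ s r n (χ : ℕ → Fin r) → Dec (GallaiSchur s r n χ)
gallaiSchur? s r n χ = map′
  (λ all a b t@(_ , _ , a+b≤n) → all (s≤s (m+n≤o⇒m≤o a a+b≤n)) (s≤s (m+n≤o⇒n≤o a a+b≤n)) t)
  (λ gs {a} _ {b} _ → gs a b)
  (allUpTo? (λ a → allUpTo? (λ b →
    schurTriple? n a b →-dec admissible? s a b (χ a) (χ b) (χ (a + b))) (suc n)) (suc n))

nonEmpty? : ∀ r n (χ : ℕ → Fin r) → Dec (AllClassesNonEmpty r n χ)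
nonEmpty? r n χ = all? λ j → map′
  (λ (x , x<1+n , 1≤x , χx≡j) → x , (1≤x , ≤-pred x<1+n) , χx≡j)
  (λ (x , (1≤x , x≤n) , χx≡j) → x , s≤s x≤n , 1≤x , χx≡j)
  (anyUpTo? (λ x → 1 ≤? x ×-dec χ x ≟ᶠ j) (suc n))

partition? : ∀ s r n (χ : ℕ → Fin r) → Dec (Partition s r n χ)
partition? s r n χ = nonEmpty? r n χ ×-dec gallaiSchur? s r n χ

-- Multiples 5q inherit the colour of q; the other residues get the Schur colouring {1,4}, {2,3}
-- of ℤ/5 in the two new colours.
blowUp : (ℕ → Fin r) → ℕ → Fin (suc (suc r))
blowUp χ 0 = suc (suc (χ 0))
blowUp χ 1 = zero
blowUp χ 2 = suc zero
blowUp χ 3 = suc zero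
blowUp χ 4 = zero
blowUp χ (suc (suc (suc (suc (suc n))))) = blowUp (χ ∘ suc) n

blowUp-multiple : ∀ (χ : ℕ → Fin r) q → blowUp χ (q * 5) ≡ suc (suc (χ q))
blowUp-multiple χ zero    = refl
blowUp-multiple χ (suc q) = blowUp-multiple (χ ∘ suc) q

blowUp-shift : ∀ (χ : ℕ → Fin r) i q → blowUp χ (i + q * 5) ≡ blowUp (λ y → χ (q + y)) i
blowUp-shift χ i zero    = cong (blowUp χ) (+-identityʳ i)
blowUp-shift χ i (suc q) =
  trans (cong (blowUp χ) (swap i (q * 5))) (blowUp-shift (χ ∘ suc) i q)
  where
  swap : ∀ i x → i + (5 + x) ≡ 5 + (i + x)
  swap = solve-∀

-- Each case has a residue ≢ 0 among i, j and so at most one colour of the form suc (suc _):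
-- Fin's _≟_ then decides every comparison from the constructors, whatever the ψs are.
blowUp-small-residues : ∀ (ψ₁ ψ₂ ψ₃ : ℕ → Fin r) (i j : Fin 5) → toℕ i + toℕ j ≢ 0 →
  let x = blowUp ψ₁ (toℕ i); y = blowUp ψ₂ (toℕ j); z = blowUp ψ₃ (toℕ i + toℕ j)
  in ¬ Monochromatic x y z × ¬ Rainbow x y z
blowUp-small-residues ψ₁ ψ₂ ψ₃ = toWitness {a? = all? λ i → all? λ j →
  ¬? (toℕ i + toℕ j ≟ 0) →-dec (¬? (monochromatic? _ _ _) ×-dec ¬? (rainbow? _ _ _))} _

blowUp-residues : ∀ (χ : ℕ → Fin r) (i j : Fin 5) q q′ → toℕ i + toℕ j ≢ 0 →
  let a = toℕ i + q * 5; b = toℕ j + q′ * 5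
  in Admissible s a b (blowUp χ a) (blowUp χ b) (blowUp χ (a + b))
blowUp-residues χ i j q q′ ij≢0 =
  admissible-resp (sym (blowUp-shift χ (toℕ i) q)) (sym (blowUp-shift χ (toℕ j) q′)) sum
    (uncurry admissible (blowUp-small-residues _ _ _ i j ij≢0))
  where
  regroup : ∀ i j q q′ → i + j + (q + q′) * 5 ≡ i + q * 5 + (j + q′ * 5)
  regroup = solve-∀
  sum : blowUp (λ y → χ (q + q′ + y)) (toℕ i + toℕ j) ≡ blowUp χ (toℕ i + q * 5 + (toℕ j + q′ * 5))
  sum = trans (sym (blowUp-shift χ (toℕ i + toℕ j) (q + q′)))
              (cong (blowUp χ) (regroup (toℕ i) (toℕ j) q q′))

blowUp-multiples : GallaiSchur s r N χ → SchurTriple (4 + N * 5) (q * 5) (q′ * 5) →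
  Admissible s (q * 5) (q′ * 5) (blowUp χ (q * 5)) (blowUp χ (q′ * 5)) (blowUp χ (q * 5 + q′ * 5))
blowUp-multiples {s = s} {r = r} {N = N} {χ = χ} {q = q} {q′} gs (1≤q5 , 1≤q′5 , bound) =
  admissible-resp (sym (blowUp-multiple χ q)) (sym (blowUp-multiple χ q′)) sum
    (admissible-distinct (distinct-unscale s 4)
      (admissible-recolour shift2 shift2-injective shift2-injective
        (gs q q′ (positive 1≤q5 , positive 1≤q′5 , unscale))))
  where
  shift2 : Fin r → Fin (suc (suc r))
  shift2 c = suc (suc c)
  shift2-injective : ∀ {c d} → shift2 c ≡ shift2 d → c ≡ d
  shift2-injective = suc-injective ∘ suc-injective
  positive : ∀ {x} → 1 ≤ x * 5 → 1 ≤ x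
  positive {suc _} _ = s≤s z≤n
  unscale : q + q′ ≤ N
  unscale = ≤-pred (*-cancelʳ-< 5 _ _
    (s≤s (subst (_≤ 4 + N * 5) (sym (*-distribʳ-+ 5 q q′)) bound)))
  sum : shift2 (χ (q + q′)) ≡ blowUp χ (q * 5 + q′ * 5)
  sum = trans (sym (blowUp-multiple χ (q + q′))) (cong (blowUp χ) (*-distribʳ-+ 5 q q′))

blowUp-gallaiSchur : GallaiSchur s r N χ → GallaiSchur s (suc (suc r)) (4 + N * 5) (blowUp χ)
blowUp-gallaiSchur {χ = χ} gs a b t with a divMod 5 | b divMod 5
... | result q zero    refl | result q′ zero    refl = blowUp-multiples {q = q} {q′} gs t
... | result q zero    refl | result q′ (suc j) refl = blowUp-residues χ zero (suc j) q q′ λ ()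
... | result q (suc i) refl | result q′ j       refl = blowUp-residues χ (suc i) j q q′ λ ()

blowUp-nonEmpty : AllClassesNonEmpty r N χ →
                  AllClassesNonEmpty (suc (suc r)) (4 + N * 5) (blowUp χ)
blowUp-nonEmpty nonEmpty zero          = 1 , (≤-refl , s≤s z≤n) , refl
blowUp-nonEmpty nonEmpty (suc zero)    = 2 , (s≤s z≤n , s≤s (s≤s z≤n)) , refl
blowUp-nonEmpty {χ = χ} nonEmpty (suc (suc j)) with nonEmpty j
... | x , (1≤x , x≤N) , χx≡j =
  x * 5 , (scale-positive 4 1≤x , ≤-trans (*-monoˡ-≤ 5 x≤N) (m≤n+m _ 4))
        , trans (blowUp-multiple χ x) (cong (λ c → suc (suc c)) χx≡j)

blowUp-partition : Partition s r N χ → Partition s (suc (suc r)) (4 + N * 5) (blowUp χ)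
blowUp-partition (nonEmpty , gs) = blowUp-nonEmpty nonEmpty , blowUp-gallaiSchur gs

schur₂ : ℕ → Fin 2
schur₂ 2 = suc zero
schur₂ 3 = suc zero
schur₂ _ = zero

weak₂ : ℕ → Fin 2
weak₂ 3 = suc zero
weak₂ 5 = suc zero
weak₂ 6 = suc zero
weak₂ 7 = suc zero
weak₂ _ = zero

weak₃ : ℕ → Fin 3
weak₃ 2  = suc zero
weak₃ 4  = suc zero
weak₃ 8  = suc zero
weak₃ 16 = suc zero
weak₃ 6  = suc (suc zero)
weak₃ 10 = suc (suc zero)
weak₃ 12 = suc (suc zero)
weak₃ 14 = suc (suc zero)
weak₃ _  = zero

construction : ∀ s r → ∃ (Partition s (suc r) (maxSize s (suc r)))
construction strong 0                   = _ , from-yes (partition? strong 1 1 λ _ → zero)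
construction strong 1                   = _ , from-yes (partition? strong 2 4 schur₂)
construction strong (suc (suc r))       = _ , blowUp-partition (proj₂ (construction strong r))
construction weak   0                   = _ , from-yes (partition? weak 1 2 λ _ → zero)
construction weak   1                   = _ , from-yes (partition? weak 2 8 weak₂)
construction weak   2                   = _ , from-yes (partition? weak 3 17 weak₃)
construction weak   (suc (suc (suc r))) = _ , blowUp-partition (proj₂ (construction weak (suc r)))

isLeastThreshold : ∀ {Has : ℕ → Set} → Has N → (∀ m → suc N ≤ m → ¬ Has m) →
                   IsLeastThreshold Has (suc N)
isLeastThreshold {N} hasN noneAbove =
  noneAbove , λ k noneFrom-k → ≮⇒≥ λ k<1+N → noneFrom-k N (≤-pred k<1+N) hasN

threshold-isLeast : ∀ s r → 1 ≤ r → IsLeastThreshold (HasPartition s r) (threshold s r)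
threshold-isLeast s (suc r) _ = isLeastThreshold (toPartition s (construction s r))
  λ m T≤m has → noGallaiSchur s r T≤m (proj₂ (fromPartition s has))

geometric : ∀ (f : ℕ → ℕ) r₀ → (∀ r → r₀ ≤ r → f (2 + r) ≡ f r * 5) →
            ∀ k {r} → r₀ ≤ r → f (2 * k + r) ≡ f r * 5 ^ k
geometric f r₀ step zero    {r} _     = sym (*-identityʳ (f r))
geometric f r₀ step (suc k) {r} r₀≤r = begin
  f (2 * suc k + r)   ≡⟨ cong (λ n → f (n + r)) (*-suc 2 k) ⟩
  f (2 + (2 * k + r)) ≡⟨ step (2 * k + r) (≤-trans r₀≤r (m≤n+m r (2 * k))) ⟩
  f (2 * k + r) * 5   ≡⟨ cong (_* 5) (geometric f r₀ step k r₀≤r) ⟩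
  f r * 5 ^ k * 5     ≡⟨ *-assoc (f r) (5 ^ k) 5 ⟩
  f r * (5 ^ k * 5)   ≡⟨ cong (f r *_) (*-comm (5 ^ k) 5) ⟩
  f r * 5 ^ suc k     ∎
  where open ≡-Reasoning

threshold-weak-step : ∀ r → 2 ≤ r → threshold weak (2 + r) ≡ threshold weak r * 5
threshold-weak-step _ (s≤s (s≤s _)) = refl

1≤n+suc : ∀ n m → 1 ≤ n + suc m
1≤n+suc n m = ≤-trans (s≤s z≤n) (m≤n+m (suc m) n)

theorem3 :
    (∀ (k : ℕ) → GSis (2 * k + 2) (5 ^ (k + 1)))
    × (∀ (k : ℕ) → GSis (2 * k + 1) (2 * 5 ^ k))
    × WGSis 1 3
    × (∀ (k : ℕ) → WGSis (2 * k + 2) (9 * 5 ^ k))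
    × (∀ (k : ℕ) → WGSis (2 * k + 3) (18 * 5 ^ k))
theorem3 =
    (λ k → subst (GSis (2 * k + 2)) (cong (5 ^_) (+-comm 1 k)) (gs-closed k 1))
  , (λ k → gs-closed k 0)
  , threshold-isLeast weak 1 ≤-refl
  , (λ k → wgs-closed k 0)
  , (λ k → wgs-closed k 1)
  where
  gs-closed : ∀ k i → GSis (2 * k + suc i) (threshold strong (suc i) * 5 ^ k)
  gs-closed k i = subst (GSis (2 * k + suc i))
    (geometric (threshold strong) 0 (λ _ _ → refl) k z≤n)
    (threshold-isLeast strong (2 * k + suc i) (1≤n+suc (2 * k) i))
  wgs-closed : ∀ k i → WGSis (2 * k + suc (suc i)) (threshold weak (suc (suc i)) * 5 ^ k)
  wgs-closed k i = subst (WGSis (2 * k + suc (suc i)))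
    (geometric (threshold weak) 2 threshold-weak-step k (s≤s (s≤s z≤n)))
    (threshold-isLeast weak (2 * k + suc (suc i)) (1≤n+suc (2 * k) (suc i)))
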